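{- Let $n,l,i$ be integers with $n\ge 2$, $2\le l\le n-1$ and $1\le i\le 4$, and let $H_n^4$ be any graph in $\mathscr{H}_n^4$ (with a recursive construction and induced labeling). Then $\lambda(\mathscr{P}_i^l,H_n^4)\le\xi_{2^l}(H_n^4)=(n-l)2^l$.
   Context: The family $\mathscr{H}_n^4$ ($n\ge 2$): $\mathscr{H}_2^4=\{K_4\}$; for $n\ge 3$, a graph is in $\mathscr{H}_n^4$ iff (up to isomorphism) it is obtained from two vertex-disjoint graphs $G_0,G_1\in\mathscr{H}_{n-1}^4$ by adding an arbitrary perfect matching between them. Each member is $(n+1)$-regular with $2^n$ vertices. Labeling: vertices of $K_4$ get labels $00,01,10,11$ bijectively; if $H_n^4$ is built from $G_0,G_1$, a vertex of $G_b$ with label $w$ gets label $bw$. An $l$-dimensional subnetwork is the subgraph induced by all vertices whose labels share a fixed prefix of length $n-l$. For $X\subseteq V(G)$, $[X,\overline{X}]$ is the set of edges with exactly one end in $X$; for $1\le m\le\lfloor|V(G)|/2\rfloor$, $\xi_m(G)=\min\{|[X,\overline{X}]|:|X|=m,\ G[X],G[\overline{X}]\text{ connected}\}$. $\lambda(\mathscr{P},G)$ is the minimum size of $F\subseteq E(G)$ with $G-F$ disconnected and every component having $\mathscr{P}$, where $\mathscr{P}_1^l$: minimum degree at least $l$; $\mathscr{P}_2^l$: average degree at least $l$; $\mathscr{P}_3^l$: at least $2^l$ vertices; $\mathscr{P}_4^l$: every vertex of $G-F$ lies in an $l$-dimensional subnetwork none of whose edges is in $F$. -}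

module Defs where

open import Data.Nat using (ℕ; zero; suc; _+_; _*_; _∸_; _^_; _≤_; _<_; _/_)
open import Data.Bool using (Bool; true; false; _∧_; _∨_; not; if_then_else_)
open import Data.Bool.Properties using () renaming (_≟_ to _≟B_)
open import Data.Vec using (Vec; []; _∷_; lookup)
open import Data.Vec.Properties using (≡-dec)
open import Data.List using (List; []; _∷_; _++_; map)
open import Data.Nat.ListAction using (sum)
open import Data.Bool.ListAction using (any)
open import Data.Fin using (Fin; toℕ)
open import Data.Product using (Σ; _×_; _,_)
open import Data.Empty using (⊥)
open import Function.Bundles using (_↔_; Inverse)
open import Relation.Nullary.Decidable using (does)
open import Relation.Binary.PropositionalEquality using (_≡_)

-- Labeled graphs on the vertex set {0,1}^n (vertex = its label).
-- A graph is given by a Bool-valued adjacency relation.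

V : ℕ → Set
V n = Vec Bool n

Adj : ℕ → Set
Adj n = V n → V n → Bool

allWords : (n : ℕ) → List (V n)
allWords zero = [] ∷ []
allWords (suc n) = map (false ∷_) (allWords n) ++ map (true ∷_) (allWords n)

eqV : ∀ {n} → V n → V n → Bool
eqV u v = does (≡-dec _≟B_ u v)

countB : ∀ {A : Set} → (A → Bool) → List A → ℕ
countB p [] = 0
countB p (x ∷ xs) = (if p x then 1 else 0) + countB p xs

size : ∀ {n} → (V n → Bool) → ℕ
size {n} X = countB X (allWords n)

deg : ∀ {n} → Adj n → V n → ℕ
deg {n} A u = countB (A u) (allWords n)

-- number of (unordered) edges of a symmetric loopless edge relation F
edgeCount : ∀ {n} → Adj n → ℕ
edgeCount {n} F = sum (map (λ u → deg F u) (allWords n)) / 2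

K4 : Adj 2
K4 u v = not (eqV u v)

-- G_0 ⊕ G_1 with perfect matching w ↦ f w (vertex 0w joined to 1(f w));
-- a vertex of G_b with label w gets label bw.
join : ∀ {n} → Adj n → Adj n → (V n ↔ V n) → Adj (suc n)
join G0 G1 f (false ∷ u) (false ∷ v) = G0 u v
join G0 G1 f (true ∷ u) (true ∷ v) = G1 u v
join G0 G1 f (false ∷ u) (true ∷ v) = eqV (Inverse.to f u) v
join G0 G1 f (true ∷ u) (false ∷ v) = eqV (Inverse.to f v) u

data H4 : (n : ℕ) → Adj n → Set where
  base : H4 2 K4
  step : ∀ {n G0 G1} (f : V n ↔ V n) → H4 n G0 → H4 n G1 →
         H4 (suc n) (join G0 G1 f)

reach : ∀ {n} → Adj n → ℕ → V n → V n → Bool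
reach A zero u v = eqV u v
reach {n} A (suc k) u v = reach A k u v ∨ any (λ w → reach A k u w ∧ A w v) (allWords n)

-- reachable at all (walks of length ≤ |V| = 2^n suffice)
reachable : ∀ {n} → Adj n → V n → V n → Bool
reachable {n} A = reach A (2 ^ n)

induced : ∀ {n} → Adj n → (V n → Bool) → Adj n
induced G X u v = X u ∧ X v ∧ G u v

Connected : ∀ {n} → Adj n → (V n → Bool) → Set
Connected G X = ∀ u v → X u ≡ true → X v ≡ true → reachable (induced G X) u v ≡ true

Disconnected : ∀ {n} → Adj n → Set
Disconnected A = Σ _ λ u → Σ _ λ v → reachable A u v ≡ false

component : ∀ {n} → Adj n → V n → (V n → Bool)
component A v = reachable A v

minus : ∀ {n} → Adj n → Adj n → Adj n
minus G F u v = G u v ∧ not (F u v)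

cut : ∀ {n} → Adj n → (V n → Bool) → ℕ
cut {n} G X = sum (map (λ u → if X u then countB (λ v → not (X v) ∧ G u v) (allWords n) else 0) (allWords n))

XiFeasible : ∀ {n} → Adj n → ℕ → (V n → Bool) → Set
XiFeasible G m X = size X ≡ m × Connected G X × Connected G (λ v → not (X v))

IsXi : ∀ {n} → Adj n → ℕ → ℕ → Set
IsXi G m k = (Σ _ λ X → XiFeasible G m X × cut G X ≡ k)
           × (∀ X → XiFeasible G m X → k ≤ cut G X)

-- Properties of components of G - F.
-- A property gets: the graph G - F, the deleted edge set F, a component C.

Property : ℕ → Set₁
Property n = Adj n → Adj n → (V n → Bool) → Set

samePrefix : ∀ {n} → ℕ → V n → V n → Set
samePrefix {n} p u w = ∀ (j : Fin n) → toℕ j < p → lookup u j ≡ lookup w j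

degSum : ∀ {n} → Adj n → (V n → Bool) → ℕ
degSum {n} A C = sum (map (λ u → if C u then deg A u else 0) (allWords n))

P1 : ∀ {n} → ℕ → Property n
P1 l A F C = ∀ u → C u ≡ true → l ≤ deg A u

-- P_2^l : average degree ≥ l   (degSum / |C| ≥ l, multiplied out)
P2 : ∀ {n} → ℕ → Property n
P2 l A F C = l * size C ≤ degSum A C

P3 : ∀ {n} → ℕ → Property n
P3 l A F C = 2 ^ l ≤ size C

-- P_4^l : every vertex lies in an l-dimensional subnetwork (vertices sharing
-- the prefix of length n-l) none of whose edges is in F
P4 : ∀ {n} → ℕ → Property n
P4 {n} l A F C = ∀ u → C u ≡ true → ∀ w w' →
  samePrefix (n ∸ l) u w → samePrefix (n ∸ l) u w' → F w w' ≡ false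

𝒫 : ∀ {n} → ℕ → ℕ → Property n
𝒫 1 l = P1 l
𝒫 2 l = P2 l
𝒫 3 l = P3 l
𝒫 4 l = P4 l
𝒫 _ l = λ _ _ _ → ⊥

LambdaLE : ∀ {n} → Property n → Adj n → ℕ → Set
LambdaLE P G k = Σ _ λ F →
    (∀ u v → F u v ≡ true → G u v ≡ true)
  × (∀ u v → F u v ≡ F v u)
  × Disconnected (minus G F)
  × (∀ v → P (minus G F) F (component (minus G F) v))
  × edgeCount F ≤ k

-- Let X be the l-dimensional subnetwork of the labels beginning with 0^(n-l) and F = [X, X̄].
-- X is a copy of H_l^4, so each of its vertices has l + 1 neighbours inside X and one matching
-- neighbour at each of the n - l levels above it; hence |F| = (n - l) 2^l.  In H - F the vertices of
-- X and of X̄ stay connected, have degree at least l, number at least 2^l on each side, and every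
-- l-dimensional subnetwork lies on one side, so F witnesses all four bounds on λ(P_i^l, H).
-- For ξ_{2^l} ≥ (n - l) 2^l: a set of m vertices spans at most m (log₂ m + 1) ordered adjacent
-- pairs, by induction along the construction, since the matching adds at most min(a, b) pairs in
-- each direction and a^a b^b 4^min(a,b) ≤ (a + b)^(a + b).  By (n + 1)-regularity a set of 2^l
-- vertices therefore has at least (n + 1) 2^l - (l + 1) 2^l boundary edges.

module Submission where

open import Defs
open import Algebra.Bundles using (CommutativeMonoid)
open import Data.Bool using (Bool; true; false; _∧_; _∨_; _xor_; not; if_then_else_) renaming (_≟_ to _≟B_)
open import Data.Bool.ListAction using (any)
open import Data.Bool.Properties using (∧-commutativeMonoid; ∧-conicalˡ; ∧-conicalʳ; ∧-identityʳ; ∨-zeroʳ; T-≡; if-cong-then; not-injective; not-involutive; xor-same; xor-comm; ¬-not)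
import Data.Fin as Fin
open import Data.List using (List; []; _∷_; _++_; map)
open import Data.List.Membership.Propositional using (_∈_; lose)
open import Data.List.Membership.Propositional.Properties using (∈-++⁺ˡ; ∈-++⁺ʳ; ∈-map⁺)
open import Data.List.Properties using (map-++; map-∘)
open import Data.List.Relation.Unary.Any using (here; satisfied)
open import Data.List.Relation.Unary.Any.Properties using (any⁺; any⁻)
open import Data.Nat using (ℕ; zero; suc; _+_; _*_; _∸_; _^_; _/_; _≤_; _<_; _≤′_; ≤′-refl; ≤′-step; z≤n; s≤s; NonZero)
open import Data.Nat.DivMod using (m*n/n≡m)
open import Data.Nat.ListAction using (sum)
open import Data.Nat.ListAction.Properties using (sum-++)
open import Data.Nat.Properties
open import Data.Nat.Tactic.RingSolver using (solve-∀)
open import Data.Product using (Σ; _×_; _,_)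
import Data.Product as Product
open import Data.Sum using (inj₁; inj₂)
open import Data.Unit using (tt)
open import Data.Vec using ([]; _∷_; replicate)
open import Data.Vec.Properties using (≡-dec)
open import Function using (_∘_; flip)
open import Function.Bundles using (_↔_; _⇔_; Inverse; Equivalence; mk⇔)
open import Relation.Binary.PropositionalEquality
open import Relation.Nullary using (yes; no; contradiction)
open import Relation.Nullary.Decidable using (dec-true; does-⇔)
open import Algebra.Properties.CommutativeSemigroup +-commutativeSemigroup
  using () renaming (interchange to +-interchange)
open import Algebra.Properties.CommutativeSemigroup *-commutativeSemigroup
  using () renaming (interchange to *-interchange)
open import Algebra.Properties.CommutativeSemigroup (CommutativeMonoid.commutativeSemigroup ∧-commutativeMonoid)
  using () renaming (x∙yz≈y∙xz to ∧-leftComm)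

∑ : {A : Set} → (A → ℕ) → List A → ℕ
∑ f xs = sum (map f xs)

𝟙 : Bool → ℕ
𝟙 b = if b then 1 else 0

module _ {A : Set} where

  ∑-++ : (f : A → ℕ) (xs ys : List A) → ∑ f (xs ++ ys) ≡ ∑ f xs + ∑ f ys
  ∑-++ f xs ys = trans (cong sum (map-++ f xs ys)) (sum-++ (map f xs) (map f ys))

  ∑-cong : {f g : A → ℕ} (xs : List A) → (∀ x → f x ≡ g x) → ∑ f xs ≡ ∑ g xs
  ∑-cong []       f≗g = refl
  ∑-cong (x ∷ xs) f≗g = cong₂ _+_ (f≗g x) (∑-cong xs f≗g)

  ∑-mono-≤ : {f g : A → ℕ} (xs : List A) → (∀ x → f x ≤ g x) → ∑ f xs ≤ ∑ g xs
  ∑-mono-≤ []       f≤g = z≤n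
  ∑-mono-≤ (x ∷ xs) f≤g = +-mono-≤ (f≤g x) (∑-mono-≤ xs f≤g)

  ∑-zero : (xs : List A) → ∑ (λ _ → 0) xs ≡ 0
  ∑-zero []       = refl
  ∑-zero (x ∷ xs) = ∑-zero xs

  ∑-distrib-+ : (f g : A → ℕ) (xs : List A) → ∑ (λ x → f x + g x) xs ≡ ∑ f xs + ∑ g xs
  ∑-distrib-+ f g []       = refl
  ∑-distrib-+ f g (x ∷ xs) =
    trans (cong (f x + g x +_) (∑-distrib-+ f g xs)) (+-interchange (f x) (g x) (∑ f xs) (∑ g xs))

  countB≡∑𝟙 : (p : A → Bool) (xs : List A) → countB p xs ≡ ∑ (𝟙 ∘ p) xs
  countB≡∑𝟙 p []       = refl
  countB≡∑𝟙 p (x ∷ xs) = cong (𝟙 (p x) +_) (countB≡∑𝟙 p xs)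

  countB-cong : {p q : A → Bool} (xs : List A) → (∀ x → p x ≡ q x) → countB p xs ≡ countB q xs
  countB-cong []       p≗q = refl
  countB-cong (x ∷ xs) p≗q = cong₂ _+_ (cong 𝟙 (p≗q x)) (countB-cong xs p≗q)

  countB-mono-≤ : {p q : A → Bool} (xs : List A) → (∀ x → p x ≡ true → q x ≡ true) →
                  countB p xs ≤ countB q xs
  countB-mono-≤ []       p⇒q = z≤n
  countB-mono-≤ (x ∷ xs) p⇒q = +-mono-≤ (𝟙-mono (p⇒q x)) (countB-mono-≤ xs p⇒q)
    where
    𝟙-mono : ∀ {a b} → (a ≡ true → b ≡ true) → 𝟙 a ≤ 𝟙 b
    𝟙-mono {false} _   = z≤n
    𝟙-mono {true}  a⇒b rewrite a⇒b refl = ≤-refl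

  countB-false : (xs : List A) → countB (λ _ → false) xs ≡ 0
  countB-false []       = refl
  countB-false (x ∷ xs) = countB-false xs

  countB-∧-split : (p q : A → Bool) (xs : List A) →
                   countB (λ x → not (q x) ∧ p x) xs + countB (λ x → q x ∧ p x) xs ≡ countB p xs
  countB-∧-split p q []       = refl
  countB-∧-split p q (x ∷ xs) with q x | p x
  ... | true  | true  = trans (+-suc _ _) (cong suc (countB-∧-split p q xs))
  ... | true  | false = countB-∧-split p q xs
  ... | false | true  = cong suc (countB-∧-split p q xs)
  ... | false | false = countB-∧-split p q xs

module _ {A B : Set} where

  ∑-map : (f : B → ℕ) (g : A → B) (xs : List A) → ∑ f (map g xs) ≡ ∑ (f ∘ g) xs
  ∑-map f g xs = cong sum (sym (map-∘ xs))

  ∑-comm : (h : A → B → ℕ) (xs : List A) (ys : List B) →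
           ∑ (λ x → ∑ (h x) ys) xs ≡ ∑ (λ y → ∑ (λ x → h x y) xs) ys
  ∑-comm h []       ys = sym (∑-zero ys)
  ∑-comm h (x ∷ xs) ys =
    trans (cong (∑ (h x) ys +_) (∑-comm h xs ys)) (sym (∑-distrib-+ (h x) (λ y → ∑ (λ x → h x y) xs) ys))

module _ {A : Set} (xs : List A) where

  -- cut G X is definitionally arcs (allWords n) G X (not ∘ X).
  arcs : (A → A → Bool) → (A → Bool) → (A → Bool) → ℕ
  arcs R S T = ∑ (λ u → if S u then countB (λ v → T v ∧ R u v) xs else 0) xs

  if-countB : (c : Bool) (p : A → Bool) → (if c then countB p xs else 0) ≡ countB (λ v → c ∧ p v) xs
  if-countB false p = sym (countB-false xs)
  if-countB true  p = refl

  ∑-if : (S : A → Bool) (d : ℕ) → ∑ (λ u → if S u then d else 0) xs ≡ d * countB S xs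
  ∑-if S d = go xs
    where
    go : (ys : List A) → ∑ (λ u → if S u then d else 0) ys ≡ d * countB S ys
    go []       = sym (*-zeroʳ d)
    go (y ∷ ys) with S y
    ... | true  = trans (cong (d +_) (go ys)) (sym (*-suc d (countB S ys)))
    ... | false = go ys

  arcs-as-∑∑ : (R : A → A → Bool) (S T : A → Bool) →
               arcs R S T ≡ ∑ (λ u → ∑ (λ v → 𝟙 (S u ∧ (T v ∧ R u v))) xs) xs
  arcs-as-∑∑ R S T = ∑-cong xs λ u →
    trans (if-countB (S u) (λ v → T v ∧ R u v)) (countB≡∑𝟙 (λ v → S u ∧ (T v ∧ R u v)) xs)

  arcs-flip : (R : A → A → Bool) (S T : A → Bool) → arcs R S T ≡ arcs (flip R) T S
  arcs-flip R S T = begin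
    arcs R S T                                                   ≡⟨ arcs-as-∑∑ R S T ⟩
    ∑ (λ u → ∑ (λ v → 𝟙 (S u ∧ (T v ∧ R u v))) xs) xs            ≡⟨ ∑-comm _ xs xs ⟩
    ∑ (λ v → ∑ (λ u → 𝟙 (S u ∧ (T v ∧ R u v))) xs) xs            ≡⟨ ∑-cong xs (λ v → ∑-cong xs λ u →
                                                                     cong 𝟙 (∧-leftComm (S u) (T v) (R u v))) ⟩
    ∑ (λ v → ∑ (λ u → 𝟙 (T v ∧ (S u ∧ R u v))) xs) xs            ≡⟨ arcs-as-∑∑ (flip R) T S ⟨
    arcs (flip R) T S                                            ∎
    where open ≡-Reasoning

  arcs-complement : (R : A → A → Bool) (S T : A → Bool) →
                    arcs R S (not ∘ T) + arcs R S T ≡ ∑ (λ u → if S u then countB (R u) xs else 0) xs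
  arcs-complement R S T = trans (sym (∑-distrib-+ _ _ xs)) (∑-cong xs split)
    where
    split : ∀ u → (if S u then countB (λ v → not (T v) ∧ R u v) xs else 0)
                  + (if S u then countB (λ v → T v ∧ R u v) xs else 0)
                ≡ (if S u then countB (R u) xs else 0)
    split u with S u
    ... | true  = countB-∧-split (R u) T xs
    ... | false = refl

  arcs-≤ : (R : A → A → Bool) (S T : A → Bool) (d : ℕ) → (∀ u → countB (R u) xs ≤ d) →
           arcs R S T ≤ d * countB S xs
  arcs-≤ R S T d deg≤d = ≤-trans (∑-mono-≤ xs bound) (≤-reflexive (∑-if S d))
    where
    bound : ∀ u → (if S u then countB (λ v → T v ∧ R u v) xs else 0) ≤ (if S u then d else 0)
    bound u with S u
    ... | true  = ≤-trans (countB-mono-≤ xs (λ v → ∧-conicalʳ (T v) (R u v))) (deg≤d u)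
    ... | false = z≤n

  arcs-matching : (R : A → A → Bool) (S : A → Bool) →
                  (∀ u → countB (R u) xs ≡ 1) → arcs R S (λ _ → true) ≡ countB S xs
  arcs-matching R S matching =
    trans (∑-cong xs (λ u → cong (λ k → if S u then k else 0) (matching u)))
          (trans (∑-if S 1) (*-identityˡ (countB S xs)))

  arcs-empty : (R : A → A → Bool) (T : A → Bool) → arcs R (λ _ → false) T ≡ 0
  arcs-empty R T = ∑-zero xs

∑-allWords-suc : ∀ n (f : V (suc n) → ℕ) →
                 ∑ f (allWords (suc n)) ≡ ∑ (f ∘ (false ∷_)) (allWords n) + ∑ (f ∘ (true ∷_)) (allWords n)
∑-allWords-suc n f = trans (∑-++ f (map (false ∷_) (allWords n)) (map (true ∷_) (allWords n)))
                             (cong₂ _+_ (∑-map f (false ∷_) (allWords n)) (∑-map f (true ∷_) (allWords n)))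

countB-allWords-suc : ∀ n (p : V (suc n) → Bool) →
                      countB p (allWords (suc n))
                        ≡ countB (p ∘ (false ∷_)) (allWords n) + countB (p ∘ (true ∷_)) (allWords n)
countB-allWords-suc n p =
  trans (countB≡∑𝟙 p (allWords (suc n))) (trans (∑-allWords-suc n (𝟙 ∘ p))
    (sym (cong₂ _+_ (countB≡∑𝟙 (p ∘ (false ∷_)) (allWords n))
                    (countB≡∑𝟙 (p ∘ (true ∷_)) (allWords n)))))

∈-allWords : ∀ {n} (u : V n) → u ∈ allWords n
∈-allWords []          = here refl
∈-allWords (false ∷ u) = ∈-++⁺ˡ (∈-map⁺ (false ∷_) (∈-allWords u))
∈-allWords (true ∷ u)  = ∈-++⁺ʳ (map (false ∷_) (allWords _)) (∈-map⁺ (true ∷_) (∈-allWords u))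

size-full : ∀ n → size {n} (λ _ → true) ≡ 2 ^ n
size-full zero    = refl
size-full (suc n) = trans (countB-allWords-suc n (λ _ → true))
                          (cong₂ _+_ (size-full n) (trans (size-full n) (sym (+-identityʳ (2 ^ n)))))

eqV-refl : ∀ {n} (u : V n) → eqV u u ≡ true
eqV-refl u = dec-true (≡-dec _≟B_ u u) refl

eqV⇒≡ : ∀ {n} {u v : V n} → eqV u v ≡ true → u ≡ v
eqV⇒≡ {u = u} {v} eq with ≡-dec _≟B_ u v
... | yes u≡v = u≡v

eqV-sym : ∀ {n} (u v : V n) → eqV u v ≡ eqV v u
eqV-sym u v = does-⇔ (mk⇔ sym sym) (≡-dec _≟B_ u v) (≡-dec _≟B_ v u)

countB-eqV : ∀ {n} (w : V n) → countB (eqV w) (allWords n) ≡ 1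
countB-eqV []                 = refl
countB-eqV {suc n} (false ∷ w) =
  trans (countB-allWords-suc n (eqV (false ∷ w))) (cong₂ _+_ (countB-eqV w) (countB-false (allWords n)))
countB-eqV {suc n} (true ∷ w)  =
  trans (countB-allWords-suc n (eqV (true ∷ w))) (cong₂ _+_ (countB-false (allWords n)) (countB-eqV w))

countB-eqV-inverse : ∀ {n} (f : V n ↔ V n) (u : V n) →
                     countB (λ v → eqV (Inverse.to f v) u) (allWords n) ≡ 1
countB-eqV-inverse {n} f u =
  trans (countB-cong (allWords n) (λ v → does-⇔ to⇔from (≡-dec _≟B_ _ _) (≡-dec _≟B_ _ _)))
        (countB-eqV (Inverse.from f u))
  where
  to⇔from : ∀ {v} → (Inverse.to f v ≡ u) ⇔ (Inverse.from f u ≡ v)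
  to⇔from = mk⇔ (λ eq → Inverse.inverseʳ f (sym eq)) (λ eq → Inverse.inverseˡ f (sym eq))

quadrant : ∀ {n} → Adj (suc n) → Bool → Bool → Adj n
quadrant R a b u v = R (a ∷ u) (b ∷ v)

half : ∀ {n} → (V (suc n) → Bool) → Bool → V n → Bool
half S a = S ∘ (a ∷_)

arcs-allWords-suc : ∀ n (R : Adj (suc n)) (S T : V (suc n) → Bool) →
  arcs (allWords (suc n)) R S T
    ≡ (arcs (allWords n) (quadrant R false false) (half S false) (half T false)
       + arcs (allWords n) (quadrant R false true) (half S false) (half T true))
      + (arcs (allWords n) (quadrant R true false) (half S true) (half T false)
         + arcs (allWords n) (quadrant R true true) (half S true) (half T true))
arcs-allWords-suc n R S T = trans (∑-allWords-suc n _) (cong₂ _+_ (row false) (row true))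
  where
  W = allWords n
  row : ∀ a → ∑ (λ u → if S (a ∷ u) then countB (λ v → T v ∧ R (a ∷ u) v) (allWords (suc n)) else 0) W
              ≡ arcs W (quadrant R a false) (half S a) (half T false) + arcs W (quadrant R a true) (half S a) (half T true)
  row a = trans (∑-cong W split) (∑-distrib-+ _ _ W)
    where
    split : ∀ u → (if S (a ∷ u) then countB (λ v → T v ∧ R (a ∷ u) v) (allWords (suc n)) else 0)
                ≡ (if S (a ∷ u) then countB (λ v → T (false ∷ v) ∧ R (a ∷ u) (false ∷ v)) W else 0)
                  + (if S (a ∷ u) then countB (λ v → T (true ∷ v) ∧ R (a ∷ u) (true ∷ v)) W else 0)
    split u with S (a ∷ u)
    ... | true  = countB-allWords-suc n _
    ... | false = refl

any-intro : ∀ {A : Set} (p : A → Bool) {x xs} → x ∈ xs → p x ≡ true → any p xs ≡ true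
any-intro p x∈xs px = Equivalence.to T-≡ (any⁺ p (lose x∈xs (Equivalence.from T-≡ px)))

any-elim : ∀ {A : Set} (p : A → Bool) xs → any p xs ≡ true → Σ A λ x → p x ≡ true
any-elim p xs e = Product.map₂ (Equivalence.to T-≡) (satisfied (any⁻ p xs (Equivalence.from T-≡ e)))

-- The index is an upper bound on the length, as in reach.
data Walk {n} (A : Adj n) : ℕ → V n → V n → Set where
  []  : ∀ {k u} → Walk A k u u
  _▷_ : ∀ {k u w v} → Walk A k u w → A w v ≡ true → Walk A (suc k) u v

module _ {n} {A : Adj n} where

  walk-step : ∀ {k u v} → Walk A k u v → Walk A (suc k) u v
  walk-step []      = []
  walk-step (p ▷ e) = walk-step p ▷ e

  walk-weaken : ∀ {j k u v} → j ≤ k → Walk A j u v → Walk A k u v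
  walk-weaken {j} {k} j≤k p = subst (λ i → Walk A i _ _) (m∸n+n≡m j≤k) (raise (k ∸ j) p)
    where
    raise : ∀ d {i u v} → Walk A i u v → Walk A (d + i) u v
    raise zero    p = p
    raise (suc d) p = walk-step (raise d p)

  walk-++ : ∀ {j k u w v} → Walk A j u w → Walk A k w v → Walk A (k + j) u v
  walk-++ {k = k} p []      = walk-weaken (m≤n+m _ k) p
  walk-++         p (q ▷ e) = walk-++ p q ▷ e

  walk-invariant : (X : V n → Bool) → (∀ a b → A a b ≡ true → X a ≡ X b) →
                   ∀ {k u v} → Walk A k u v → X u ≡ X v
  walk-invariant X inv []      = refl
  walk-invariant X inv (p ▷ e) = trans (walk-invariant X inv p) (inv _ _ e)

  reach-refl : ∀ k u → reach A k u u ≡ true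
  reach-refl zero    u = eqV-refl u
  reach-refl (suc k) u rewrite reach-refl k u = refl

  walk⇒reach : ∀ {k u v} → Walk A k u v → reach A k u v ≡ true
  walk⇒reach {k} []                            = reach-refl k _
  walk⇒reach {suc k} {u} {v} (_▷_ {w = w} p e) =
    trans (cong (reach A k u v ∨_) (any-intro (λ x → reach A k u x ∧ A x v) (∈-allWords w)
                                               (cong₂ _∧_ (walk⇒reach p) e)))
          (∨-zeroʳ (reach A k u v))

  reach⇒walk : ∀ k {u v} → reach A k u v ≡ true → Walk A k u v
  reach⇒walk zero    e = subst (Walk A 0 _) (eqV⇒≡ e) []
  reach⇒walk (suc k) {u} {v} e with reach A k u v in r
  ... | true  = walk-step (reach⇒walk k r)
  ... | false with any-elim (λ x → reach A k u x ∧ A x v) (allWords n) e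
  ... | w , rw∧e = reach⇒walk k (∧-conicalˡ _ _ rw∧e) ▷ ∧-conicalʳ _ _ rw∧e

n<2^n : ∀ n → n < 2 ^ n
n<2^n zero    = s≤s z≤n
n<2^n (suc n) = +-mono-≤ (m^n>0 2 n) (≤-trans (n<2^n n) (m≤m+n (2 ^ n) 0))

walk⇒reachable : ∀ {n} {A : Adj n} {k u v} → k ≤ 2 ^ n → Walk A k u v → reachable A u v ≡ true
walk⇒reachable k≤2ⁿ p = walk⇒reach (walk-weaken k≤2ⁿ p)

walk-map : ∀ {n m} {A : Adj n} {B : Adj m} (g : V n → V m) →
           (∀ a b → A a b ≡ true → B (g a) (g b) ≡ true) →
           ∀ {k u v} → Walk A k u v → Walk B k (g u) (g v)
walk-map g hom []      = []
walk-map g hom (p ▷ e) = walk-map g hom p ▷ hom _ _ e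

reachable-mono : ∀ {n} {A B : Adj n} → (∀ a b → A a b ≡ true → B a b ≡ true) →
                 ∀ {u v} → reachable A u v ≡ true → reachable B u v ≡ true
reachable-mono {n} A⊆B r = walk⇒reach (walk-map (λ x → x) A⊆B (reach⇒walk (2 ^ n) r))

reachable-invariant : ∀ {n} {A : Adj n} (X : V n → Bool) → (∀ a b → A a b ≡ true → X a ≡ X b) →
                      ∀ {u v} → reachable A u v ≡ true → X u ≡ X v
reachable-invariant {n} X inv r = walk-invariant X inv (reach⇒walk (2 ^ n) r)

H4-regular : ∀ {n G} → H4 n G → ∀ u → deg G u ≡ suc n
H4-regular base (false ∷ false ∷ []) = refl
H4-regular base (false ∷ true ∷ [])  = refl
H4-regular base (true ∷ false ∷ [])  = refl
H4-regular base (true ∷ true ∷ [])   = refl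
H4-regular {suc n} (step f h₀ h₁) (false ∷ u) =
  trans (countB-allWords-suc n _) (trans (cong₂ _+_ (H4-regular h₀ u) (countB-eqV (Inverse.to f u))) (+-comm (suc n) 1))
H4-regular {suc n} (step f h₀ h₁) (true ∷ u) =
  trans (countB-allWords-suc n _) (cong₂ _+_ (countB-eqV-inverse f u) (H4-regular h₁ u))

H4-symmetric : ∀ {n G} → H4 n G → ∀ u v → G u v ≡ G v u
H4-symmetric base u v = cong not (eqV-sym u v)
H4-symmetric (step f h₀ h₁) (false ∷ u) (false ∷ v) = H4-symmetric h₀ u v
H4-symmetric (step f h₀ h₁) (false ∷ u) (true ∷ v)  = refl
H4-symmetric (step f h₀ h₁) (true ∷ u)  (false ∷ v) = refl
H4-symmetric (step f h₀ h₁) (true ∷ u)  (true ∷ v)  = H4-symmetric h₁ u v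

H4-walk : ∀ {n G} → H4 n G → ∀ u v → Walk G n u v
H4-walk base u v with eqV u v in u≡v
... | true  = subst (Walk K4 2 u) (eqV⇒≡ u≡v) []
... | false = walk-step ([] ▷ cong not u≡v)
H4-walk (step f h₀ h₁) (false ∷ u) (false ∷ v) = walk-step (walk-map (false ∷_) (λ _ _ e → e) (H4-walk h₀ u v))
H4-walk (step f h₀ h₁) (true ∷ u)  (true ∷ v)  = walk-step (walk-map (true ∷_) (λ _ _ e → e) (H4-walk h₁ u v))
H4-walk (step f h₀ h₁) (false ∷ u) (true ∷ v)  =
  walk-map (false ∷_) (λ _ _ e → e) (H4-walk h₀ u (Inverse.from f v))
    ▷ subst (λ w → eqV w v ≡ true) (sym (Inverse.strictlyInverseˡ f v)) (eqV-refl v)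
H4-walk (step f h₀ h₁) (true ∷ u)  (false ∷ v) =
  walk-map (true ∷_) (λ _ _ e → e) (H4-walk h₁ u (Inverse.to f v)) ▷ eqV-refl (Inverse.to f v)

^-distribʳ-* : ∀ a b k → (a * b) ^ k ≡ a ^ k * b ^ k
^-distribʳ-* a b zero    = refl
^-distribʳ-* a b (suc k) = trans (cong (a * b *_) (^-distribʳ-* a b k)) (*-interchange a b (a ^ k) (b ^ k))

succ-pow-≤ : ∀ P k → suc P ^ suc k ≤ P ^ suc k + suc k * suc P ^ k
succ-pow-≤ P zero    = ≤-reflexive (linear P)
  where
  linear : ∀ P → suc P * 1 ≡ P * 1 + 1 * 1
  linear = solve-∀
succ-pow-≤ P (suc k) = begin
  suc P * suc P ^ suc k                                     ≤⟨ *-monoʳ-≤ (suc P) (succ-pow-≤ P k) ⟩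
  suc P * (P ^ suc k + suc k * suc P ^ k)                   ≡⟨ expand P k (P ^ suc k) (suc P ^ k) ⟩
  P * P ^ suc k + P ^ suc k + suc k * suc P ^ suc k         ≤⟨ +-monoˡ-≤ _ (+-monoʳ-≤ (P * P ^ suc k)
                                                                 (^-monoˡ-≤ (suc k) (n≤1+n P))) ⟩
  P * P ^ suc k + suc P ^ suc k + suc k * suc P ^ suc k     ≡⟨ +-assoc (P * P ^ suc k) _ _ ⟩
  P * P ^ suc k + suc (suc k) * suc P ^ suc k               ∎
  where
  open ≤-Reasoning
  expand : ∀ P k a b → suc P * (a + suc k * b) ≡ P * a + a + suc k * (suc P * b)
  expand = solve-∀

-- Log-convexity of x ↦ x^x.
selfPow-convex : ∀ x → suc x ^ suc x * suc x ^ suc x ≤ suc (suc x) ^ suc (suc x) * x ^ x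
selfPow-convex zero       = ≤ᵇ⇒≤ 1 4 tt
selfPow-convex x@(suc _) = begin
  q ^ q * q ^ q            ≡⟨ ^-distribʳ-* q q q ⟨
  q * q * B                ≡⟨ *-assoc q q B ⟩
  q * (q * B)              ≤⟨ *-monoʳ-≤ q qB≤ ⟩
  q * (x ^ x * r ^ q)      ≤⟨ *-monoˡ-≤ (x ^ x * r ^ q) (n≤1+n q) ⟩
  r * (x ^ x * r ^ q)      ≡⟨ rearrange r (x ^ x) (r ^ q) ⟩
  r ^ r * x ^ x            ∎
  where
  open ≤-Reasoning
  q r P B : ℕ
  q = suc x
  r = suc q
  P = x * r
  B = (q * q) ^ x
  rearrange : ∀ r a b → r * (a * b) ≡ r * b * a
  rearrange = solve-∀
  sucP : suc P ≡ q * q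
  sucP = lemma x
    where
    lemma : ∀ x → suc (x * suc (suc x)) ≡ suc x * suc x
    lemma = solve-∀
  bernoulli : q * q * B ≤ x * (x ^ x * r ^ q) + q * B
  bernoulli = begin
    q * q * B                      ≡⟨ cong (λ z → z ^ q) sucP ⟨
    suc P ^ q                      ≤⟨ succ-pow-≤ P x ⟩
    P ^ q + q * suc P ^ x          ≡⟨ cong₂ (λ a b → a + q * b ^ x) (^-distribʳ-* x r q) sucP ⟩
    x ^ q * r ^ q + q * B          ≡⟨ cong (_+ q * B) (*-assoc x (x ^ x) (r ^ q)) ⟩
    x * (x ^ x * r ^ q) + q * B    ∎
  qB≤ : q * B ≤ x ^ x * r ^ q
  qB≤ = *-cancelˡ-≤ x (+-cancelʳ-≤ (q * B) _ _
          (≤-trans (≤-reflexive (split x B)) bernoulli))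
    where
    split : ∀ x B → x * (suc x * B) + suc x * B ≡ suc x * suc x * B
    split = solve-∀

selfPow-nonZero : ∀ c → NonZero (c ^ c)
selfPow-nonZero zero    = _
selfPow-nonZero (suc c) = m^n≢0 (suc c) (suc c)

selfPow-ratio-mono : ∀ {b c} → b ≤′ c → c ^ c * suc b ^ suc b ≤ suc c ^ suc c * b ^ b
selfPow-ratio-mono {b} ≤′-refl = ≤-reflexive (*-comm (b ^ b) (suc b ^ suc b))
selfPow-ratio-mono {b} (≤′-step {c} b≤c) = *-cancelˡ-≤ (c ^ c) {{selfPow-nonZero c}} (begin
  c ^ c * (A * Z)              ≡⟨ swap (c ^ c) A Z ⟩
  A * (c ^ c * Z)              ≤⟨ *-monoʳ-≤ A (selfPow-ratio-mono b≤c) ⟩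
  A * (A * b ^ b)              ≡⟨ *-assoc A A (b ^ b) ⟨
  A * A * b ^ b                ≤⟨ *-monoˡ-≤ (b ^ b) (selfPow-convex c) ⟩
  C * c ^ c * b ^ b            ≡⟨ trans (*-assoc C (c ^ c) (b ^ b)) (swap C (c ^ c) (b ^ b)) ⟩
  c ^ c * (C * b ^ b)          ∎)
  where
  open ≤-Reasoning
  A = suc c ^ suc c
  C = suc (suc c) ^ suc (suc c)
  Z = suc b ^ suc b
  swap : ∀ x y z → x * (y * z) ≡ y * (x * z)
  swap = solve-∀

-- (a + b)^(a + b) / (a^a b^b) equals 4^a at b = a and grows with b.
selfPow-balanced : ∀ {a b} → a ≤′ b → a ^ a * b ^ b * 4 ^ a ≤ (a + b) ^ (a + b)
selfPow-balanced {a} ≤′-refl = ≤-reflexive (begin-equality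
  a ^ a * a ^ a * 4 ^ a          ≡⟨ cong (_* 4 ^ a) (^-distribʳ-* a a a) ⟨
  (a * a) ^ a * 4 ^ a            ≡⟨ ^-distribʳ-* (a * a) 4 a ⟨
  (a * a * 4) ^ a                ≡⟨ cong (_^ a) (square a) ⟩
  ((a + a) * (a + a)) ^ a        ≡⟨ ^-distribʳ-* (a + a) (a + a) a ⟩
  (a + a) ^ a * (a + a) ^ a      ≡⟨ ^-distribˡ-+-* (a + a) a a ⟨
  (a + a) ^ (a + a)              ∎)
  where
  open ≤-Reasoning
  square : ∀ a → a * a * 4 ≡ (a + a) * (a + a)
  square = solve-∀
selfPow-balanced {a} (≤′-step {b} a≤b) rewrite +-suc a b =
  *-cancelˡ-≤ (b ^ b) {{selfPow-nonZero b}} (begin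
    b ^ b * (a ^ a * Z * 4 ^ a)          ≡⟨ shuffle (b ^ b) (a ^ a) Z (4 ^ a) ⟩
    a ^ a * b ^ b * 4 ^ a * Z            ≤⟨ *-monoˡ-≤ Z (selfPow-balanced a≤b) ⟩
    (a + b) ^ (a + b) * Z                ≤⟨ selfPow-ratio-mono (≤⇒≤′ (m≤n+m b a)) ⟩
    suc (a + b) ^ suc (a + b) * b ^ b    ≡⟨ *-comm _ (b ^ b) ⟩
    b ^ b * suc (a + b) ^ suc (a + b)    ∎)
  where
  open ≤-Reasoning
  Z = suc b ^ suc b
  shuffle : ∀ w x y z → w * (x * y * z) ≡ x * w * z * y
  shuffle = solve-∀

selfPow-split : ∀ a b c → c ≤ a → c ≤ b → a ^ a * b ^ b * 4 ^ c ≤ (a + b) ^ (a + b)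
selfPow-split a b c c≤a c≤b with ≤-total a b
... | inj₁ a≤b = ≤-trans (*-monoʳ-≤ (a ^ a * b ^ b) (^-monoʳ-≤ 4 c≤a)) (selfPow-balanced (≤⇒≤′ a≤b))
... | inj₂ b≤a = begin
  a ^ a * b ^ b * 4 ^ c          ≡⟨ cong (_* 4 ^ c) (*-comm (a ^ a) (b ^ b)) ⟩
  b ^ b * a ^ a * 4 ^ c          ≤⟨ *-monoʳ-≤ (b ^ b * a ^ a) (^-monoʳ-≤ 4 c≤b) ⟩
  b ^ b * a ^ a * 4 ^ b          ≤⟨ selfPow-balanced (≤⇒≤′ b≤a) ⟩
  (b + a) ^ (b + a)              ≡⟨ cong (λ z → z ^ z) (+-comm b a) ⟩
  (a + b) ^ (a + b)              ∎
  where open ≤-Reasoning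

-- e ≤ m (log₂ m + 1), stated without logarithms.
IsoBound : ℕ → ℕ → Set
IsoBound m e = 2 ^ e ≤ m ^ m * 2 ^ m

isoBound-merge : ∀ {a b e₀ e₁} c → IsoBound a e₀ → IsoBound b e₁ → c ≤ a → c ≤ b →
                 IsoBound (a + b) ((e₀ + c) + (c + e₁))
isoBound-merge {a} {b} {e₀} {e₁} c bound₀ bound₁ c≤a c≤b = begin
  2 ^ ((e₀ + c) + (c + e₁))                   ≡⟨ powers e₀ c e₁ ⟩
  2 ^ e₀ * 2 ^ e₁ * 4 ^ c                     ≤⟨ *-monoˡ-≤ (4 ^ c) (*-mono-≤ bound₀ bound₁) ⟩
  a ^ a * 2 ^ a * (b ^ b * 2 ^ b) * 4 ^ c     ≡⟨ shuffle (a ^ a) (2 ^ a) (b ^ b) (2 ^ b) (4 ^ c) ⟩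
  a ^ a * b ^ b * 4 ^ c * (2 ^ a * 2 ^ b)     ≤⟨ *-monoˡ-≤ _ (selfPow-split a b c c≤a c≤b) ⟩
  (a + b) ^ (a + b) * (2 ^ a * 2 ^ b)         ≡⟨ cong ((a + b) ^ (a + b) *_) (^-distribˡ-+-* 2 a b) ⟨
  (a + b) ^ (a + b) * 2 ^ (a + b)             ∎
  where
  open ≤-Reasoning
  shuffle : ∀ x y z w v → x * y * (z * w) * v ≡ x * z * v * (y * w)
  shuffle = solve-∀
  powers : ∀ e₀ c e₁ → 2 ^ ((e₀ + c) + (c + e₁)) ≡ 2 ^ e₀ * 2 ^ e₁ * 4 ^ c
  powers e₀ c e₁ = begin-equality
    2 ^ ((e₀ + c) + (c + e₁))               ≡⟨ ^-distribˡ-+-* 2 (e₀ + c) (c + e₁) ⟩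
    2 ^ (e₀ + c) * 2 ^ (c + e₁)             ≡⟨ cong₂ _*_ (^-distribˡ-+-* 2 e₀ c) (^-distribˡ-+-* 2 c e₁) ⟩
    2 ^ e₀ * 2 ^ c * (2 ^ c * 2 ^ e₁)       ≡⟨ regroup (2 ^ e₀) (2 ^ c) (2 ^ e₁) ⟩
    2 ^ e₀ * 2 ^ e₁ * (2 ^ c * 2 ^ c)       ≡⟨ cong (2 ^ e₀ * 2 ^ e₁ *_) (^-distribʳ-* 2 2 c) ⟨
    2 ^ e₀ * 2 ^ e₁ * 4 ^ c                 ∎
    where
    regroup : ∀ x y z → x * y * (y * z) ≡ x * z * (y * y)
    regroup = solve-∀

isoperimetric : ∀ {n G} → H4 n G → ∀ X → IsoBound (size X) (arcs (allWords n) G X X)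
isoperimetric base X
  with X (false ∷ false ∷ []) | X (false ∷ true ∷ []) | X (true ∷ false ∷ []) | X (true ∷ true ∷ [])
... | false | false | false | false = ≤ᵇ⇒≤ _ _ tt
... | false | false | false | true  = ≤ᵇ⇒≤ _ _ tt
... | false | false | true  | false = ≤ᵇ⇒≤ _ _ tt
... | false | false | true  | true  = ≤ᵇ⇒≤ _ _ tt
... | false | true  | false | false = ≤ᵇ⇒≤ _ _ tt
... | false | true  | false | true  = ≤ᵇ⇒≤ _ _ tt
... | false | true  | true  | false = ≤ᵇ⇒≤ _ _ tt
... | false | true  | true  | true  = ≤ᵇ⇒≤ _ _ tt
... | true  | false | false | false = ≤ᵇ⇒≤ _ _ tt
... | true  | false | false | true  = ≤ᵇ⇒≤ _ _ tt
... | true  | false | true  | false = ≤ᵇ⇒≤ _ _ tt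
... | true  | false | true  | true  = ≤ᵇ⇒≤ _ _ tt
... | true  | true  | false | false = ≤ᵇ⇒≤ _ _ tt
... | true  | true  | false | true  = ≤ᵇ⇒≤ _ _ tt
... | true  | true  | true  | false = ≤ᵇ⇒≤ _ _ tt
... | true  | true  | true  | true  = ≤ᵇ⇒≤ _ _ tt
isoperimetric {suc n} (step {G0 = G₀} {G1 = G₁} f h₀ h₁) X =
  subst₂ IsoBound (sym (countB-allWords-suc n X)) (sym decomposition)
    (isoBound-merge {e₀ = arcs W G₀ X₀ X₀} {e₁ = arcs W G₁ X₁ X₁} c
                    (isoperimetric h₀ X₀) (isoperimetric h₁ X₁) c≤|X₀| c≤|X₁|)
  where
  W = allWords n
  X₀ X₁ : V n → Bool
  X₀ = X ∘ (false ∷_)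
  X₁ = X ∘ (true ∷_)
  M : Adj n
  M u v = eqV (Inverse.to f u) v
  c : ℕ
  c = arcs W M X₀ X₁
  decomposition : arcs (allWords (suc n)) (join G₀ G₁ f) X X ≡ (arcs W G₀ X₀ X₀ + c) + (c + arcs W G₁ X₁ X₁)
  decomposition = trans (arcs-allWords-suc n (join G₀ G₁ f) X X)
                        (cong (λ c′ → (arcs W G₀ X₀ X₀ + c) + (c′ + arcs W G₁ X₁ X₁))
                              (sym (arcs-flip W M X₀ X₁)))
  c≤|X₀| : c ≤ size X₀
  c≤|X₀| = ≤-trans (arcs-≤ W M X₀ X₁ 1 (λ u → ≤-reflexive (countB-eqV (Inverse.to f u))))
                   (≤-reflexive (*-identityˡ (size X₀)))
  c≤|X₁| : c ≤ size X₁
  c≤|X₁| = ≤-trans (≤-reflexive (arcs-flip W M X₀ X₁))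
             (≤-trans (arcs-≤ W (flip M) X₁ X₀ 1 (λ u → ≤-reflexive (countB-eqV-inverse f u)))
                      (≤-reflexive (*-identityˡ (size X₁))))

isoBound-2^ : ∀ {l e} → IsoBound (2 ^ l) e → e ≤ suc l * 2 ^ l
isoBound-2^ {l} {e} bound = 2^-cancel-≤ (begin
  2 ^ e                                  ≤⟨ bound ⟩
  (2 ^ l) ^ (2 ^ l) * 2 ^ (2 ^ l)        ≡⟨ cong (_* 2 ^ (2 ^ l)) (^-*-assoc 2 l (2 ^ l)) ⟩
  2 ^ (l * 2 ^ l) * 2 ^ (2 ^ l)          ≡⟨ ^-distribˡ-+-* 2 (l * 2 ^ l) (2 ^ l) ⟨
  2 ^ (l * 2 ^ l + 2 ^ l)                ≡⟨ cong (2 ^_) (+-comm (l * 2 ^ l) (2 ^ l)) ⟩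
  2 ^ (suc l * 2 ^ l)                    ∎)
  where
  open ≤-Reasoning
  2^-cancel-≤ : ∀ {a b} → 2 ^ a ≤ 2 ^ b → a ≤ b
  2^-cancel-≤ {a} {b} 2ᵃ≤2ᵇ with a ≤? b
  ... | yes a≤b = a≤b
  ... | no  a≰b = contradiction 2ᵃ≤2ᵇ (<⇒≱ (^-monoʳ-< 2 (s≤s (s≤s z≤n)) (≰⇒> a≰b)))

cut+arcs-regular : ∀ {n d} {G : Adj n} → (∀ u → deg G u ≡ d) → ∀ X →
                   cut G X + arcs (allWords n) G X X ≡ d * size X
cut+arcs-regular {n} {d} {G} regular X =
  trans (arcs-complement W G X X)
        (trans (∑-cong W (λ u → cong (λ k → if X u then k else 0) (regular u))) (∑-if W X d))
  where W = allWords n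

cut-lower-bound : ∀ {k l G} → H4 (k + l) G → ∀ X → size X ≡ 2 ^ l → k * 2 ^ l ≤ cut G X
cut-lower-bound {k} {l} {G} h X |X|≡2ˡ = +-cancelʳ-≤ (suc l * 2 ^ l) _ _ (begin
  k * 2 ^ l + suc l * 2 ^ l              ≡⟨ *-distribʳ-+ (2 ^ l) k (suc l) ⟨
  (k + suc l) * 2 ^ l                    ≡⟨ cong₂ _*_ (+-suc k l) (sym |X|≡2ˡ) ⟩
  suc (k + l) * size X                   ≡⟨ cut+arcs-regular (H4-regular h) X ⟨
  cut G X + arcs (allWords _) G X X      ≤⟨ +-monoʳ-≤ (cut G X) internal-arcs ⟩
  cut G X + suc l * 2 ^ l                ∎)
  where
  open ≤-Reasoning
  internal-arcs : arcs (allWords _) G X X ≤ suc l * 2 ^ l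
  internal-arcs = isoBound-2^ {l} (subst (λ m → IsoBound m (arcs (allWords _) G X X)) |X|≡2ˡ
                                        (isoperimetric h X))

cutEdges : ∀ {n} → Adj n → (V n → Bool) → Adj n
cutEdges G X u v = (X u xor X v) ∧ G u v

minus-cutEdges : ∀ {n} (G : Adj n) X u v → minus G (cutEdges G X) u v ≡ not (X u xor X v) ∧ G u v
minus-cutEdges G X u v = ∧-not-∧ (X u xor X v) (G u v)
  where
  ∧-not-∧ : ∀ b g → g ∧ not (b ∧ g) ≡ not b ∧ g
  ∧-not-∧ false g     = ∧-identityʳ g
  ∧-not-∧ true  false = refl
  ∧-not-∧ true  true  = refl

cutEdges-degree-sum : ∀ {n} (G : Adj n) → (∀ u v → G u v ≡ G v u) → ∀ X →
                      ∑ (deg (cutEdges G X)) (allWords n) ≡ cut G X * 2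
cutEdges-degree-sum {n} G symmetric X = begin
  ∑ (deg (cutEdges G X)) W                          ≡⟨ ∑-cong W by-side ⟩
  ∑ (λ u → (if X u then countB (λ v → not (X v) ∧ G u v) W else 0)
           + (if not (X u) then countB (λ v → X v ∧ G u v) W else 0)) W
                                                    ≡⟨ ∑-distrib-+ _ _ W ⟩
  cut G X + arcs W G (not ∘ X) X                    ≡⟨ cong (cut G X +_) (arcs-flip W G (not ∘ X) X) ⟩
  cut G X + arcs W (flip G) X (not ∘ X)             ≡⟨ cong (cut G X +_) (∑-cong W λ u → if-cong-then (X u)
                                                         (countB-cong W λ v → cong (not (X v) ∧_) (symmetric v u))) ⟩
  cut G X + cut G X                                 ≡⟨ cong (cut G X +_) (+-identityʳ (cut G X)) ⟨
  2 * cut G X                                       ≡⟨ *-comm 2 (cut G X) ⟩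
  cut G X * 2                                       ∎
  where
  open ≡-Reasoning
  W = allWords n
  by-side : ∀ u → deg (cutEdges G X) u ≡ (if X u then countB (λ v → not (X v) ∧ G u v) W else 0)
                                         + (if not (X u) then countB (λ v → X v ∧ G u v) W else 0)
  by-side u with X u
  ... | true  = sym (+-identityʳ _)
  ... | false = refl

edgeCount-cutEdges : ∀ {n} (G : Adj n) → (∀ u v → G u v ≡ G v u) → ∀ X → edgeCount (cutEdges G X) ≡ cut G X
edgeCount-cutEdges G symmetric X = trans (cong (_/ 2) (cutEdges-degree-sum G symmetric X)) (m*n/n≡m (cut G X) 2)

minDegree⇒averageDegree : ∀ {n l} (A : Adj n) → (∀ u → l ≤ deg A u) → ∀ C → l * size C ≤ degSum A C
minDegree⇒averageDegree {n} {l} A minDeg C =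
  ≤-trans (≤-reflexive (sym (∑-if (allWords n) C l)))
          (∑-mono-≤ (allWords n) (λ u → if-mono (C u) (minDeg u)))
  where
  if-mono : ∀ b {x y} → x ≤ y → (if b then x else 0) ≤ (if b then y else 0)
  if-mono true  x≤y = x≤y
  if-mono false _   = z≤n

zeroPrefix : ℕ → ∀ {n} → V n → Bool
zeroPrefix zero    u       = true
zeroPrefix (suc k) []      = true
zeroPrefix (suc k) (b ∷ u) = not b ∧ zeroPrefix k u

zeroPrefix-replicate : ∀ k n → zeroPrefix k (replicate n false) ≡ true
zeroPrefix-replicate zero    n       = refl
zeroPrefix-replicate (suc k) zero    = refl
zeroPrefix-replicate (suc k) (suc n) = zeroPrefix-replicate k n

zeroPrefix-samePrefix : ∀ p {n} (u w : V n) → samePrefix p u w → zeroPrefix p u ≡ zeroPrefix p w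
zeroPrefix-samePrefix zero    u       w       _    = refl
zeroPrefix-samePrefix (suc p) []      []      _    = refl
zeroPrefix-samePrefix (suc p) (a ∷ u) (b ∷ w) same =
  cong₂ (λ x y → not x ∧ y) (same Fin.zero (s≤s z≤n))
        (zeroPrefix-samePrefix p u w (λ j j<p → same (Fin.suc j) (s≤s j<p)))

size-zeroPrefix : ∀ k l → size {k + l} (zeroPrefix k) ≡ 2 ^ l
size-zeroPrefix zero    l = size-full l
size-zeroPrefix (suc k) l = trans (countB-allWords-suc (k + l) (zeroPrefix (suc k)))
  (trans (cong₂ _+_ (size-zeroPrefix k l) (countB-false (allWords (k + l)))) (+-identityʳ (2 ^ l)))

module ZeroPrefixSubnetwork {l} (2≤l : 2 ≤ l) where

  K4-has-no-proper-subnetwork : ∀ k → suc k + l ≢ 2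
  K4-has-no-proper-subnetwork k eq with subst (2 ≤_) (suc-injective eq) (≤-trans 2≤l (m≤n+m l k))
  ... | s≤s ()

  cut-zeroPrefix : ∀ k {n G} → H4 n G → k + l ≡ n → cut G (zeroPrefix k) ≡ k * 2 ^ l
  cut-zeroPrefix zero    {n} _ _ = trans (∑-cong (allWords n) (λ _ → countB-false (allWords n))) (∑-zero (allWords n))
  cut-zeroPrefix (suc k) base eq = contradiction eq (K4-has-no-proper-subnetwork k)
  cut-zeroPrefix (suc k) {suc m} (step {G0 = G₀} {G1 = G₁} f h₀ h₁) eq = begin
    cut (join G₀ G₁ f) (zeroPrefix (suc k))
      ≡⟨ arcs-allWords-suc m (join G₀ G₁ f) (zeroPrefix (suc k)) (not ∘ zeroPrefix (suc k)) ⟩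
    (cut G₀ X₀ + arcs W M X₀ (λ _ → true))
      + (arcs W (flip M) (λ _ → false) (not ∘ X₀) + arcs W G₁ (λ _ → false) (λ _ → true))
      ≡⟨ cong₂ _+_ (cong₂ _+_ (cut-zeroPrefix k h₀ (suc-injective eq))
                              (arcs-matching W M X₀ (λ u → countB-eqV (Inverse.to f u))))
                   (cong₂ _+_ (arcs-empty W (flip M) (not ∘ X₀)) (arcs-empty W G₁ (λ _ → true))) ⟩
    (k * 2 ^ l + size X₀) + 0
      ≡⟨ trans (+-identityʳ _) (+-comm (k * 2 ^ l) (size X₀)) ⟩
    size X₀ + k * 2 ^ l
      ≡⟨ cong (_+ k * 2 ^ l) (subst (λ n → size {n} (zeroPrefix k) ≡ 2 ^ l) (suc-injective eq)
                                     (size-zeroPrefix k l)) ⟩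
    suc k * 2 ^ l ∎
    where
    open ≡-Reasoning
    W = allWords m
    X₀ : V m → Bool
    X₀ = zeroPrefix k
    M : Adj m
    M u v = eqV (Inverse.to f u) v

  zeroPrefix-walk : ∀ k {n G} → H4 n G → k + l ≡ n →
                    ∀ {u v} → zeroPrefix k u ≡ true → zeroPrefix k v ≡ true → Walk (induced G (zeroPrefix k)) l u v
  zeroPrefix-walk zero    h eq {u} {v} _ _ =
    walk-weaken (≤-reflexive (sym eq)) (walk-map (λ x → x) (λ _ _ e → e) (H4-walk h u v))
  zeroPrefix-walk (suc k) base eq = contradiction eq (K4-has-no-proper-subnetwork k)
  zeroPrefix-walk (suc k) (step f h₀ h₁) eq {false ∷ u} {false ∷ v} u∈ v∈ =
    walk-map (false ∷_) (λ _ _ e → e) (zeroPrefix-walk k h₀ (suc-injective eq) u∈ v∈)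

  zeroPrefix-degree : ∀ k {n G} → H4 n G → k + l ≡ n → ∀ u → zeroPrefix k u ≡ true →
                      countB (λ v → zeroPrefix k v ∧ G u v) (allWords n) ≡ suc l
  zeroPrefix-degree zero    h eq u _ = trans (H4-regular h u) (cong suc (sym eq))
  zeroPrefix-degree (suc k) base eq = contradiction eq (K4-has-no-proper-subnetwork k)
  zeroPrefix-degree (suc k) {suc m} (step f h₀ h₁) eq (false ∷ u) u∈ =
    trans (countB-allWords-suc m _)
          (trans (cong₂ _+_ (zeroPrefix-degree k h₀ (suc-injective eq) u u∈) (countB-false (allWords m)))
                 (+-identityʳ (suc l)))

  zeroPrefix-complement-degree : ∀ k {n G} → H4 n G → k + l ≡ n → ∀ u → zeroPrefix k u ≡ false →
                                 l ≤ countB (λ v → not (zeroPrefix k v) ∧ G u v) (allWords n)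
  zeroPrefix-complement-degree (suc k) base eq = contradiction eq (K4-has-no-proper-subnetwork k)
  zeroPrefix-complement-degree (suc k) {suc m} (step f h₀ h₁) eq (false ∷ u) u∉ =
    ≤-trans (zeroPrefix-complement-degree k h₀ (suc-injective eq) u u∉)
            (≤-trans (m≤m+n _ _) (≤-reflexive (sym (countB-allWords-suc m _))))
  zeroPrefix-complement-degree (suc k) {suc m} (step {G1 = G₁} f h₀ h₁) eq (true ∷ u) _ = begin
    l                                         ≤⟨ ≤-trans (m≤n+m l k) (≤-reflexive (suc-injective eq)) ⟩
    m                                         ≤⟨ n≤1+n m ⟩
    suc m                                     ≡⟨ H4-regular h₁ u ⟨
    deg G₁ u                                  ≤⟨ m≤n+m _ _ ⟩
    _ + deg G₁ u                              ≡⟨ countB-allWords-suc m _ ⟨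
    countB _ (allWords (suc m))               ∎
    where open ≤-Reasoning

  zeroPrefix-complement-walk : ∀ k {n G} → H4 n G → suc k + l ≡ n → ∀ {u v} →
                               zeroPrefix (suc k) u ≡ false → zeroPrefix (suc k) v ≡ false →
                               Walk (induced G (not ∘ zeroPrefix (suc k))) (suc n) u v
  zeroPrefix-complement-walk k base eq = contradiction eq (K4-has-no-proper-subnetwork k)
  zeroPrefix-complement-walk k {suc m} {G} (step f h₀ h₁) eq = go
    where
    Y : V (suc m) → Bool
    Y = not ∘ zeroPrefix (suc k)
    within₁ : ∀ a b → Walk (induced G Y) m (true ∷ a) (true ∷ b)
    within₁ a b = walk-map (true ∷_) (λ _ _ e → e) (H4-walk h₁ a b)
    up : ∀ {u} → zeroPrefix k u ≡ false → induced G Y (false ∷ u) (true ∷ Inverse.to f u) ≡ true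
    up {u} u∉ = cong₂ _∧_ (cong not u∉) (eqV-refl (Inverse.to f u))
    down : ∀ {v} → zeroPrefix k v ≡ false → induced G Y (true ∷ Inverse.to f v) (false ∷ v) ≡ true
    down {v} v∉ = cong₂ _∧_ (cong not v∉) (eqV-refl (Inverse.to f v))
    go : ∀ {u v} → zeroPrefix (suc k) u ≡ false → zeroPrefix (suc k) v ≡ false →
         Walk (induced G Y) (suc (suc m)) u v
    go {true ∷ u}  {true ∷ v}  _  _  = walk-step (walk-step (within₁ u v))
    go {true ∷ u}  {false ∷ v} _  v∉ = walk-step (within₁ u _ ▷ down v∉)
    go {false ∷ u} {true ∷ v}  u∉ _  =
      walk-weaken (≤-trans (≤-reflexive (+-comm m 1)) (n≤1+n _)) (walk-++ ([] ▷ up u∉) (within₁ _ v))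
    go {false ∷ u} {false ∷ v} u∉ v∉ =
      walk-weaken (≤-reflexive (+-comm (suc m) 1)) (walk-++ ([] ▷ up u∉) (within₁ _ _ ▷ down v∉))

module CutAlongZeroPrefix {k l} (2≤l : 2 ≤ l) {G : Adj (suc k + l)} (h : H4 (suc k + l) G) where
  open ZeroPrefixSubnetwork 2≤l

  N : ℕ
  N = suc k + l

  X : V N → Bool
  X = zeroPrefix (suc k)

  F G∖F : Adj N
  F   = cutEdges G X
  G∖F = minus G F

  |X| : size X ≡ 2 ^ l
  |X| = size-zeroPrefix (suc k) l

  |X̄| : 2 ^ l ≤ size (not ∘ X)
  |X̄| = begin
    2 ^ l                                          ≤⟨ ^-monoʳ-≤ 2 (m≤n+m l k) ⟩
    2 ^ (k + l)                                    ≡⟨ size-full (k + l) ⟨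
    size {k + l} (λ _ → true)                      ≤⟨ m≤n+m _ _ ⟩
    _ + size {k + l} (λ _ → true)                  ≡⟨ countB-allWords-suc (k + l) (not ∘ X) ⟨
    size (not ∘ X)                                 ∎
    where open ≤-Reasoning

  X-connected : Connected G X
  X-connected _ _ u∈ v∈ = walk⇒reachable (≤-trans (m≤n+m l (suc k)) (<⇒≤ (n<2^n N)))
                                          (zeroPrefix-walk (suc k) h refl u∈ v∈)

  X̄-connected : Connected G (not ∘ X)
  X̄-connected _ _ u∉ v∉ = walk⇒reachable (n<2^n N)
                            (zeroPrefix-complement-walk k h refl (not-injective u∉) (not-injective v∉))

  ξ-value : IsXi G (2 ^ l) (suc k * 2 ^ l)
  ξ-value = (X , (|X| , X-connected , X̄-connected) , cut-zeroPrefix (suc k) h refl)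
          , λ Y (|Y| , _) → cut-lower-bound {suc k} {l} h Y |Y|

  G∖F-edge⇒same-side : ∀ {a b} → G∖F a b ≡ true → X a ≡ X b
  G∖F-edge⇒same-side {a} {b} e =
    not-xor (X a) (X b) (∧-conicalˡ _ _ (trans (sym (minus-cutEdges G X a b)) e))
    where
    not-xor : ∀ x y → not (x xor y) ≡ true → x ≡ y
    not-xor false false _ = refl
    not-xor true  true  _ = refl

  same-side-edge⇒G∖F : ∀ {a b} → X a ≡ X b → G a b ≡ true → G∖F a b ≡ true
  same-side-edge⇒G∖F {a} {b} Xa≡Xb e = begin
    G∖F a b                     ≡⟨ minus-cutEdges G X a b ⟩
    not (X a xor X b) ∧ G a b   ≡⟨ cong₂ (λ x y → not (x xor X b) ∧ y) Xa≡Xb e ⟩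
    not (X b xor X b) ∧ true    ≡⟨ cong (λ x → not x ∧ true) (xor-same (X b)) ⟩
    true                        ∎
    where open ≡-Reasoning

  G∖F-disconnected : Disconnected G∖F
  G∖F-disconnected = replicate N false , replicate N true , ¬-not unreachable
    where
    unreachable : reachable G∖F (replicate N false) (replicate N true) ≢ true
    unreachable r
      with trans (sym (zeroPrefix-replicate (suc k) N)) (reachable-invariant X (λ _ _ → G∖F-edge⇒same-side) r)
    ... | ()

  G∖F-degree-inside : ∀ {u} → X u ≡ true → l ≤ deg G∖F u
  G∖F-degree-inside {u} u∈ =
    ≤-trans (n≤1+n l) (≤-reflexive (sym (trans (countB-cong (allWords N) same-side)
                                               (zeroPrefix-degree (suc k) h refl u u∈))))
    where
    same-side : ∀ v → G∖F u v ≡ X v ∧ G u v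
    same-side v = trans (trans (minus-cutEdges G X u v) (cong (λ x → not (x xor X v) ∧ G u v) u∈))
                        (cong (_∧ G u v) (not-involutive (X v)))

  G∖F-degree-outside : ∀ {u} → X u ≡ false → l ≤ deg G∖F u
  G∖F-degree-outside {u} u∉ =
    ≤-trans (zeroPrefix-complement-degree (suc k) h refl u u∉) (≤-reflexive (countB-cong (allWords N) same-side))
    where
    same-side : ∀ v → not (X v) ∧ G u v ≡ G∖F u v
    same-side v = sym (trans (minus-cutEdges G X u v) (cong (λ x → not (x xor X v) ∧ G u v) u∉))

  G∖F-min-degree : ∀ u → l ≤ deg G∖F u
  G∖F-min-degree u with X u ≟B true
  ... | yes u∈ = G∖F-degree-inside u∈
  ... | no  u∉ = G∖F-degree-outside (¬-not u∉)

  side⊆G∖F : ∀ {S} → (∀ {a b} → S a ≡ true → S b ≡ true → X a ≡ X b) →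
             ∀ a b → induced G S a b ≡ true → G∖F a b ≡ true
  side⊆G∖F {S} same-side a b e = same-side-edge⇒G∖F (same-side a∈S b∈S) (∧-conicalʳ (S b) (G a b) b∈S∧e)
    where
    a∈S : S a ≡ true
    a∈S = ∧-conicalˡ (S a) _ e
    b∈S∧e : S b ∧ G a b ≡ true
    b∈S∧e = ∧-conicalʳ (S a) _ e
    b∈S : S b ≡ true
    b∈S = ∧-conicalˡ (S b) (G a b) b∈S∧e

  component-size : ∀ v → 2 ^ l ≤ size (component G∖F v)
  component-size v with X v ≟B true
  ... | yes v∈ = ≤-trans (≤-reflexive (sym |X|)) (countB-mono-≤ (allWords N) λ u u∈ →
                   reachable-mono (side⊆G∖F (λ a∈ b∈ → trans a∈ (sym b∈))) (X-connected v u v∈ u∈))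
  ... | no  v∉ = ≤-trans |X̄| (countB-mono-≤ (allWords N) λ u u∉ →
                   reachable-mono (side⊆G∖F (λ a∉ b∉ → not-injective (trans a∉ (sym b∉))))
                                  (X̄-connected v u (cong not (¬-not v∉)) u∉))

  F-inside-subnetworks : ∀ u w w′ → samePrefix (N ∸ l) u w → samePrefix (N ∸ l) u w′ → F w w′ ≡ false
  F-inside-subnetworks u w w′ u~w u~w′ =
    cong (_∧ G w w′) (trans (cong (_xor X w′) (trans (sym (same-X w u~w)) (same-X w′ u~w′)))
                            (xor-same (X w′)))
    where
    same-X : ∀ x → samePrefix (N ∸ l) u x → X u ≡ X x
    same-X x u~x =
      zeroPrefix-samePrefix (suc k) u x (subst (λ p → samePrefix p u x) (m+n∸n≡m (suc k) l) u~x)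

  components-satisfy : ∀ i → 1 ≤ i → i ≤ 4 → ∀ v → 𝒫 i l G∖F F (component G∖F v)
  components-satisfy 1 _ _ v u _       = G∖F-min-degree u
  components-satisfy 2 _ _ v           = minDegree⇒averageDegree G∖F G∖F-min-degree (component G∖F v)
  components-satisfy 3 _ _ v           = component-size v
  components-satisfy 4 _ _ v u _       = F-inside-subnetworks u
  components-satisfy (suc (suc (suc (suc (suc _))))) _ (s≤s (s≤s (s≤s (s≤s ()))))

  λ-bound : ∀ i → 1 ≤ i → i ≤ 4 → LambdaLE (𝒫 i l) G (suc k * 2 ^ l)
  λ-bound i 1≤i i≤4 = F
                    , (λ u v → ∧-conicalʳ _ _)
                    , (λ u v → cong₂ _∧_ (xor-comm (X u) (X v)) (H4-symmetric h u v))
                    , G∖F-disconnected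
                    , components-satisfy i 1≤i i≤4
                    , ≤-reflexive (trans (edgeCount-cutEdges G (H4-symmetric h) X) (cut-zeroPrefix (suc k) h refl))

lemma6p1 : (n l i : ℕ) → 2 ≤ n → 2 ≤ l → l ≤ n ∸ 1 → 1 ≤ i → i ≤ 4 →
    (G : Adj n) → H4 n G →
    Σ ℕ λ ξ → IsXi G (2 ^ l) ξ × ξ ≡ (n ∸ l) * 2 ^ l × LambdaLE (𝒫 i l) G ξ
lemma6p1 (suc n) l i _ 2≤l l≤n 1≤i i≤4 G h with n ∸ l | m∸n+n≡m l≤n
... | k | refl = suc k * 2 ^ l , ξ-value , cong (_* 2 ^ l) (sym (m+n∸n≡m (suc k) l)) , λ-bound i 1≤i i≤4
  where open CutAlongZeroPrefix 2≤l h
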